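{- If $\Gamma'$ is a full (induced) subgraph of a graph $\Gamma$ with property R, then $\Gamma'$ has property R.
   Context: For a set $P$ with a symmetric reflexive relation $\mathcal{C}$: a labelled heap is $(E,\le,\varepsilon)$ with $(E,\le)$ a finite poset, $\varepsilon:E\to P$, such that elements with $\varepsilon(a)\,\mathcal{C}\,\varepsilon(b)$ are comparable and $\le$ is the transitive closure of "$a\le b$ and $\varepsilon(a)\,\mathcal{C}\,\varepsilon(b)$"; heaps are label-preserving isomorphism classes, forming $H(P,\mathcal{C})$. $E(v)$ is the subheap on $E\setminus\{v\}$ (order: transitive closure of the same relation restricted). Trivial heap: trivial order. Convex chain: chain $x_1<\dots<x_t$ containing every $y$ with $x_i<y<x_j$; length $t$; balanced if $\varepsilon(x_1)=\varepsilon(x_t)$. Property P2: no balanced convex chain of length 2 or 3. $E(a)\prec^+E$ if $a$ is maximal in $E$ and some element maximal in $E(a)$ but not in $E$ has label $\ne\varepsilon(a)$; $\prec^-$ likewise with minimal elements; $\prec$ means either. Property P1: there is a (possibly trivial) sequence $E_1\prec\cdots\prec E$ with $E_1$ trivial. The concurrency graph of $H(P,\mathcal{C})$ has vertices $P$ and edges between distinct $v,w$ with $v\,\mathcal{C}\,w$. A graph has property R if it is the concurrency graph of a class of heaps in which every heap with property P2 has property P1. -}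

module Defs where

open import Data.Nat using (ℕ; zero; suc)
open import Data.Fin using (Fin; zero; suc; punchIn; fromℕ) renaming (_<_ to _<ᶠ_)
open import Data.Product using (Σ; ∃; _×_; _,_)
open import Data.Sum using (_⊎_)
open import Relation.Nullary using (¬_)
open import Relation.Binary.PropositionalEquality using (_≡_; _≢_)
open import Relation.Binary.Construct.Closure.ReflexiveTransitive using (Star)
open import Function.Definitions using (Injective)

record Graph : Set₁ where
  field
    V        : Set
    _~_      : V → V → Set
    ~-sym    : ∀ {v w} → v ~ w → w ~ v
    ~-irrefl : ∀ {v} → ¬ (v ~ v)

-- The symmetric reflexive relation 𝒞 whose concurrency graph is Γ:
-- v 𝒞 w iff v = w or v, w adjacent.
Conc : (Γ : Graph) → Graph.V Γ → Graph.V Γ → Set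
Conc Γ v w = v ≡ w ⊎ Graph._~_ Γ v w

FullSubgraph : Graph → Graph → Set
FullSubgraph Γ' Γ =
  Σ (Graph.V Γ' → Graph.V Γ) λ f →
    Injective _≡_ _≡_ f ×
    (∀ v w → (Graph._~_ Γ' v w → Graph._~_ Γ (f v) (f w))
           × (Graph._~_ Γ (f v) (f w) → Graph._~_ Γ' v w))

record LStruct (P : Set) (n : ℕ) : Set₁ where
  field
    lab : Fin n → P
    _≤_ : Fin n → Fin n → Set

module Heaps {P : Set} (C : P → P → Set) where

  module _ {n : ℕ} (E : LStruct P n) where
    open LStruct E

    Cov : Fin n → Fin n → Set
    Cov a b = (a ≤ b) × C (lab a) (lab b)

    _<_ : Fin n → Fin n → Set
    a < b = (a ≤ b) × (a ≢ b)

    record IsHeap : Set where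
      field
        refl     : ∀ a → a ≤ a
        antisym  : ∀ a b → a ≤ b → b ≤ a → a ≡ b
        trans    : ∀ a b c → a ≤ b → b ≤ c → a ≤ c
        comparable : ∀ a b → C (lab a) (lab b) → (a ≤ b) ⊎ (b ≤ a)
        closure⇒ : ∀ a b → a ≤ b → Star Cov a b
        closure⇐ : ∀ a b → Star Cov a b → a ≤ b

    Trivial : Set
    Trivial = ∀ a b → a ≤ b → a ≡ b

    Maximal : Fin n → Set
    Maximal a = ∀ b → a ≤ b → b ≡ a

    Minimal : Fin n → Set
    Minimal a = ∀ b → b ≤ a → b ≡ a

    IsConvexChain : ∀ {m} → (Fin m → Fin n) → Set
    IsConvexChain x =
      (∀ i j → i <ᶠ j → x i < x j) ×
      (∀ i j y → x i < y → y < x j → ∃ λ k → y ≡ x k)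

    -- Property P2: no balanced convex chain of length 2 or 3
    P2 : Set
    P2 = ∀ m → (m ≡ 1 ⊎ m ≡ 2) → (x : Fin (suc m) → Fin n) →
         IsConvexChain x → lab (x zero) ≢ lab (x (fromℕ m))

  remove : ∀ {n} → LStruct P (suc n) → Fin (suc n) → LStruct P n
  remove E v = record
    { lab = λ x → LStruct.lab E (punchIn v x)
    ; _≤_ = Star (λ x y → Cov E (punchIn v x) (punchIn v y))
    }

  Prec⁺ : ∀ {n} (E : LStruct P (suc n)) → Fin (suc n) → Set
  Prec⁺ E a = Maximal E a ×
    ∃ λ x → Maximal (remove E a) x × ¬ Maximal E (punchIn a x)
            × LStruct.lab E (punchIn a x) ≢ LStruct.lab E a

  Prec⁻ : ∀ {n} (E : LStruct P (suc n)) → Fin (suc n) → Set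
  Prec⁻ E a = Minimal E a ×
    ∃ λ x → Minimal (remove E a) x × ¬ Minimal E (punchIn a x)
            × LStruct.lab E (punchIn a x) ≢ LStruct.lab E a

  -- Property P1: a sequence E₁ ≺ ⋯ ≺ E with E₁ trivial (built from the top).
  data P1 : ∀ {n} → LStruct P n → Set₁ where
    base : ∀ {n} {E : LStruct P n} → Trivial E → P1 E
    step : ∀ {n} {E : LStruct P (suc n)} (a : Fin (suc n)) →
           (Prec⁺ E a ⊎ Prec⁻ E a) → P1 (remove E a) → P1 E

PropertyR : Graph → Set₁
PropertyR Γ = ∀ n (E : LStruct (Graph.V Γ) n) →
  IsHeap E → P2 E → P1 E
  where open Heaps (Conc Γ)

module Submission where

open import Defs
open import Data.Nat using (suc)
open import Data.Fin using (Fin; punchIn)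
open import Data.Product using (_,_; proj₁; proj₂)
open import Data.Sum using (map)
open import Function.Bundles using (_⇔_; mk⇔; module Equivalence)
open import Function.Definitions using (Injective)
open import Relation.Binary.PropositionalEquality using (_≡_; _≢_; refl; cong; sym; trans; subst₂)
open import Relation.Binary.Construct.Closure.ReflexiveTransitive as Star using (Star)

-- A heap over Γ' becomes a heap over Γ by relabelling along the embedding f, with the same
-- order: since f preserves and reflects concurrency, the covering relations coincide. P2
-- transfers forward because f is injective, so R for Γ yields a ≺-sequence for the relabelled
-- heap; removing an element commutes with relabelling, so that sequence is one for the
-- original heap.

module Relabelling {P Q : Set} (C : P → P → Set) (D : Q → Q → Set) (f : P → Q)
                   (f-conc : ∀ v w → C v w ⇔ D (f v) (f w)) where

  module HC = Heaps C
  module HD = Heaps D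
  open LStruct
  open Equivalence using (to; from)

  relabel : ∀ {n} → LStruct P n → LStruct Q n
  relabel E = record { lab = λ x → f (lab E x) ; _≤_ = _≤_ E }

  -- Needed because remove (relabel E) a is not definitionally relabel (remove E a):
  -- removal recloses the order under Cov, which mentions the relation on labels.
  record Relabelled {n} (E : LStruct P n) (E' : LStruct Q n) : Set where
    field
      lab-≡ : ∀ x → lab E' x ≡ f (lab E x)
      ≤⇒≤′  : ∀ {x y} → _≤_ E x y → _≤_ E' x y
      ≤′⇒≤  : ∀ {x y} → _≤_ E' x y → _≤_ E x y

  relabel-relabelled : ∀ {n} (E : LStruct P n) → Relabelled E (relabel E)
  relabel-relabelled E = record { lab-≡ = λ _ → refl ; ≤⇒≤′ = λ p → p ; ≤′⇒≤ = λ p → p }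

  module _ {n} {E : LStruct P n} {E' : LStruct Q n} (R : Relabelled E E') where
    open Relabelled R

    conc-⇔ : ∀ x y → C (lab E x) (lab E y) ⇔ D (lab E' x) (lab E' y)
    conc-⇔ x y = mk⇔
      (λ c → subst₂ D (sym (lab-≡ x)) (sym (lab-≡ y)) (to (f-conc _ _) c))
      (λ d → from (f-conc _ _) (subst₂ D (lab-≡ x) (lab-≡ y) d))

    Cov⇒Cov′ : ∀ {x y} → HC.Cov E x y → HD.Cov E' x y
    Cov⇒Cov′ {x} {y} (p , c) = ≤⇒≤′ p , to (conc-⇔ x y) c

    Cov′⇒Cov : ∀ {x y} → HD.Cov E' x y → HC.Cov E x y
    Cov′⇒Cov {x} {y} (p , d) = ≤′⇒≤ p , from (conc-⇔ x y) d

    Maximal-⇔ : ∀ a → HC.Maximal E a ⇔ HD.Maximal E' a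
    Maximal-⇔ a = mk⇔ (λ m b p → m b (≤′⇒≤ p)) (λ m b p → m b (≤⇒≤′ p))

    Minimal-⇔ : ∀ a → HC.Minimal E a ⇔ HD.Minimal E' a
    Minimal-⇔ a = mk⇔ (λ m b p → m b (≤′⇒≤ p)) (λ m b p → m b (≤⇒≤′ p))

    lab′-≢⇒lab-≢ : ∀ x y → lab E' x ≢ lab E' y → lab E x ≢ lab E y
    lab′-≢⇒lab-≢ x y ne e = ne (trans (lab-≡ x) (trans (cong f e) (sym (lab-≡ y))))

  remove-relabelled : ∀ {n} {E : LStruct P (suc n)} {E' : LStruct Q (suc n)} →
                      Relabelled E E' → ∀ a → Relabelled (HC.remove E a) (HD.remove E' a)
  remove-relabelled R a = record
    { lab-≡ = λ x → Relabelled.lab-≡ R (punchIn a x)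
    ; ≤⇒≤′  = Star.map (Cov⇒Cov′ R)
    ; ≤′⇒≤  = Star.map (Cov′⇒Cov R)
    }

  module _ {n} {E : LStruct P (suc n)} {E' : LStruct Q (suc n)} (R : Relabelled E E') (a : Fin (suc n)) where
    private
      R₋ = remove-relabelled R a

    Prec⁺-reflect : HD.Prec⁺ E' a → HC.Prec⁺ E a
    Prec⁺-reflect (m , x , mx , ¬m , ne) =
      from (Maximal-⇔ R a) m , x , from (Maximal-⇔ R₋ x) mx ,
      (λ m′ → ¬m (to (Maximal-⇔ R _) m′)) , lab′-≢⇒lab-≢ R _ a ne

    Prec⁻-reflect : HD.Prec⁻ E' a → HC.Prec⁻ E a
    Prec⁻-reflect (m , x , mx , ¬m , ne) =
      from (Minimal-⇔ R a) m , x , from (Minimal-⇔ R₋ x) mx ,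
      (λ m′ → ¬m (to (Minimal-⇔ R _) m′)) , lab′-≢⇒lab-≢ R _ a ne

  P1-reflect : ∀ {n} {E : LStruct P n} {E' : LStruct Q n} → Relabelled E E' → HD.P1 E' → HC.P1 E
  P1-reflect R (HD.base t)        = HC.base (λ a b p → t a b (Relabelled.≤⇒≤′ R p))
  P1-reflect R (HD.step a pr E₋) =
    HC.step a (map (Prec⁺-reflect R a) (Prec⁻-reflect R a) pr)
              (P1-reflect (remove-relabelled R a) E₋)

  IsHeap-relabel : ∀ {n} {E : LStruct P n} → HC.IsHeap E → HD.IsHeap (relabel E)
  IsHeap-relabel {E = E} h = record
    { refl       = H.refl
    ; antisym    = H.antisym
    ; trans      = H.trans
    ; comparable = λ a b d → H.comparable a b (from (conc-⇔ R a b) d)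
    ; closure⇒   = λ a b p → Star.map (Cov⇒Cov′ R) (H.closure⇒ a b p)
    ; closure⇐   = λ a b s → H.closure⇐ a b (Star.map (Cov′⇒Cov R) s)
    }
    where
      module H = HC.IsHeap h
      R = relabel-relabelled E

  P2-relabel : Injective _≡_ _≡_ f → ∀ {n} (E : LStruct P n) → HC.P2 E → HD.P2 (relabel E)
  P2-relabel f-inj E p2 m m≡ x chain balanced = p2 m m≡ x chain (f-inj balanced)

FullSubgraph-Conc-⇔ : ∀ {Γ Γ'} (F : FullSubgraph Γ' Γ) →
                      ∀ v w → Conc Γ' v w ⇔ Conc Γ (proj₁ F v) (proj₁ F w)
FullSubgraph-Conc-⇔ (f , f-inj , f-adj) v w =
  mk⇔ (map (cong f) (proj₁ (f-adj v w))) (map f-inj (proj₂ (f-adj v w)))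

lemma3p1p3 : (Γ Γ' : Graph) → FullSubgraph Γ' Γ → PropertyR Γ → PropertyR Γ'
lemma3p1p3 Γ Γ' F@(f , f-inj , _) R n E heap p2 =
  P1-reflect (relabel-relabelled E)
    (R n (relabel E) (IsHeap-relabel heap) (P2-relabel f-inj E p2))
  where open Relabelling (Conc Γ') (Conc Γ) f (FullSubgraph-Conc-⇔ {Γ} {Γ'} F)
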